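{- $\mathfrak m_1(4)=1$, $\mathfrak m_2(4)=4$, $\mathfrak m_3(4)=4$, $\mathfrak m_4(4)=5$, $\mathfrak m_5(4)=7$.
   Context: For $N\in\mathbb N^*=\mathbb N\setminus\{0\}$, let $\mathfrak M(N)$ be the family of arrays $\mathfrak A=(a^n_i)$ with $N$ rows, each row an infinite strictly increasing sequence of reals. The spectrum of $\mathfrak A$ is the set of all sums $\lambda=\sum_{n=1}^N a^n_{j_n}$ with $(j_1,\dots,j_N)\in(\mathbb N^*)^N$, and the multiplicity of $\lambda$ is the number of such $N$-tuples representing it. Ordering the spectrum as a non-decreasing sequence $\lambda_1(\mathfrak A)\le\lambda_2(\mathfrak A)\le\dots$ counted with multiplicity, set $m(k,\mathfrak A)$ = multiplicity of $\lambda_k(\mathfrak A)$ and $\mathfrak m_k(N)=\sup_{\mathfrak A\in\mathfrak M(N)} m(k,\mathfrak A)$. Here $N=4$. -}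

module Defs where

open import Level using (0ℓ)
open import Data.Nat as ℕ using (ℕ; zero; suc)
open import Data.Vec using (Vec; []; _∷_)
open import Data.List using (List; length)
open import Data.List.Membership.Propositional using (_∈_)
open import Data.List.Relation.Unary.Unique.Propositional using (Unique)
open import Data.List.Relation.Unary.All using (All)
open import Data.Product using (Σ; ∃; ∃-syntax; _×_; _,_)
open import Data.Sum using (_⊎_)
open import Function.Bundles using (_⇔_)
open import Relation.Binary.PropositionalEquality using (_≡_)
open import Relation.Binary.Structures using (IsStrictTotalOrder)
open import Algebra.Structures using (IsCommutativeRing)
open import Relation.Nullary using (¬_)
open import Data.Unit using (⊤)

-- The real numbers, axiomatised as a (Dedekind-)complete ordered field.
-- Any two such structures are isomorphic, so quantifying over all of
-- them is the same as working with ℝ.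

record RealField : Set₁ where
  infixl 6 _+_
  infixl 7 _*_
  infix  4 _<_ _≤_
  field
    Carrier : Set
    _+_ _*_ : Carrier → Carrier → Carrier
    -_      : Carrier → Carrier
    0# 1#   : Carrier
    _<_     : Carrier → Carrier → Set
    isCommutativeRing : IsCommutativeRing _≡_ _+_ _*_ -_ 0# 1#
    isStrictTotalOrder : IsStrictTotalOrder _≡_ _<_
    0≢1     : ¬ (0# ≡ 1#)
    inverse : ∀ x → ¬ (x ≡ 0#) → ∃[ y ] (x * y ≡ 1#)
    +-mono-< : ∀ {x y} z → x < y → x + z < y + z
    *-pos    : ∀ {x y} → 0# < x → 0# < y → 0# < x * y

  _≤_ : Carrier → Carrier → Set
  x ≤ y = x < y ⊎ x ≡ y

  field
    complete : (P : Carrier → Set) → ∃ P → (∃[ b ] (∀ x → P x → x ≤ b)) →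
               ∃[ s ] ((∀ x → P x → x ≤ s) ×
                       (∀ b → (∀ x → P x → x ≤ b) → s ≤ b))

module _ (R : RealField) where
  open RealField R

  -- An array with N rows; row n is the sequence i ↦ a n i, indexed from 0
  -- (index i here corresponds to index i+1 in the paper).
  Array : ℕ → Set
  Array N = Vec (ℕ → Carrier) N

  StrictlyIncreasing : ∀ {N} → Array N → Set
  StrictlyIncreasing []       = ⊤
  StrictlyIncreasing (a ∷ as) = (∀ i → a i < a (suc i)) × StrictlyIncreasing as

  specSum : ∀ {N} → Array N → Vec ℕ N → Carrier
  specSum []       []       = 0#
  specSum (a ∷ as) (j ∷ js) = a j + specSum as js

  CountIs : ∀ {N} → (Vec ℕ N → Set) → ℕ → Set
  CountIs {N} P c = ∃[ L ] (length L ≡ c × Unique L × (∀ (t : Vec ℕ N) → (t ∈ L ⇔ P t)))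

  AtLeast : ∀ {N} → (Vec ℕ N → Set) → ℕ → Set
  AtLeast {N} P c = ∃[ L ] (length L ≡ c × Unique L × All P L)

  -- v is the k-th element (k ≥ 1) of the spectrum listed non-decreasingly
  -- with multiplicity: fewer than k elements (counted with multiplicity)
  -- are < v, and at least k are ≤ v.
  IsKth : ∀ {N} → Array N → ℕ → Carrier → Set
  IsKth A k v = (∃[ a ] (CountIs (λ t → specSum A t < v) a × a ℕ.< k))
              × AtLeast (λ t → specSum A t ≤ v) k

  Mult : ∀ {N} → Array N → Carrier → ℕ → Set
  Mult A v m = CountIs (λ t → specSum A t ≡ v) m

  MultOfKth : ∀ {N} → Array N → ℕ → ℕ → Set
  MultOfKth A k m = ∃[ v ] (IsKth A k v × Mult A v m)

  -- 𝔪_k(N) = c : c is the supremum (attained maximum) of m(k,A) over 𝔐(N)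
  SupMultIs : ℕ → ℕ → ℕ → Set
  SupMultIs N k c =
    (∀ (A : Array N) → StrictlyIncreasing A → ∀ m → MultOfKth A k m → m ℕ.≤ c)
    × (Σ (Array N) λ A → StrictlyIncreasing A × MultOfKth A k c)

-- Order ℕ⁴ componentwise. Adding to an index of a strictly increasing array
-- strictly increases the spectral sum, so if v is the k-th spectral value then the
-- tuples with sum < v form an order ideal D with |D| < k, and every tuple with sum
-- exactly v is a minimal element ("corner") of the complement of D. Hence
-- m(k, 𝔄) is at most the largest number of corners of an ideal of ℕ⁴ with at most
-- k − 1 elements. For k ≤ 5 such an ideal lies in the finite set of tuples with at
-- most 4 strict predecessors, and the maximal corner counts 1, 4, 4, 5, 7 are found
-- by exhaustive search. They are attained by the arrays with rows j ↦ wₙ · j for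
-- suitable weights w ∈ {1, 2}⁴.

module Submission where

open import Algebra.Bundles using (Ring)
import Algebra.Properties.Ring as RingProperties
open import Algebra.Structures using (IsCommutativeRing)
open import Data.Bool using (true; false)
open import Data.Empty using (⊥; ⊥-elim)
open import Data.List
  using (List; []; _∷_; [_]; _++_; map; filter; length; take; upTo; cartesianProductWith)
import Data.List.Membership.DecPropositional as DecMembership
open import Data.List.Membership.Propositional using (_∈_; _∉_)
open import Data.List.Membership.Propositional.Properties
  using ( ∈-cartesianProductWith⁺; ∈-cartesianProductWith⁻; ∈-upTo⁺; ∈-upTo⁻
        ; ∈-filter⁺; ∈-filter⁻; ∈-map⁺; ∈-++⁺ˡ; ∈-++⁺ʳ; ∈-++⁻; ∈-∃++)
open import Data.List.Properties using (length-++; length-map; length-upTo; length-take; length-++-sucʳ)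
open import Data.List.Relation.Binary.Subset.Propositional using (_⊆_)
import Data.List.Relation.Binary.Subset.DecPropositional as DecSubset
open import Data.List.Relation.Unary.All as All using (All; []; _∷_; all?)
import Data.List.Relation.Unary.All.Properties as AllP
open import Data.List.Relation.Unary.AllPairs using ([]; _∷_)
open import Data.List.Relation.Unary.Any using (here; there)
open import Data.List.Relation.Unary.Unique.Propositional using (Unique)
import Data.List.Relation.Unary.Unique.Propositional.Properties as Unique
open import Data.Nat as ℕ using (ℕ; zero; suc; z≤n; s≤s; _≤?_; _<?_)
import Data.Nat.Properties as ℕₚ
open import Data.Product using (_×_; _,_; proj₁; proj₂)
open import Data.Sum using (inj₁; inj₂)
open import Data.Vec using (Vec; []; _∷_; replicate)
open import Data.Vec.Properties using (≡-dec; ∷-injective)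
open import Data.Vec.Relation.Binary.Pointwise.Inductive as Pointwise using (Pointwise; []; _∷_)
open import Function using (_∘_)
open import Function.Bundles using (_⇔_; mk⇔; Equivalence)
open import Relation.Binary.Definitions using (tri<; tri≈; tri>)
open import Relation.Binary.Structures using (IsStrictTotalOrder)
open import Relation.Binary.PropositionalEquality
  using (_≡_; _≢_; refl; sym; trans; cong; cong₂; subst; subst₂; module ≡-Reasoning)
open import Relation.Nullary using (Dec; does; yes; no; ¬?; _×-dec_; _→-dec_)
open import Relation.Nullary.Decidable using (True; toWitness; from-yes)
open import Relation.Unary using (Decidable)

open import Defs

length-mono-⊆ : ∀ {A : Set} {xs ys : List A} → Unique xs → xs ⊆ ys → length xs ℕ.≤ length ys
length-mono-⊆ {xs = []}     _             _     = z≤n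
length-mono-⊆ {xs = x ∷ xs} (x∉xs ∷ xs!) xs⊆ys with ∈-∃++ (xs⊆ys (here refl))
... | ys₁ , ys₂ , refl =
  subst (suc (length xs) ℕ.≤_) (sym (length-++-sucʳ ys₁ x ys₂)) (s≤s (length-mono-⊆ xs! xs⊆ys₁++ys₂))
  where
  xs⊆ys₁++ys₂ : xs ⊆ ys₁ ++ ys₂
  xs⊆ys₁++ys₂ y∈xs with ∈-++⁻ ys₁ (xs⊆ys (there y∈xs))
  ... | inj₁ y∈ys₁         = ∈-++⁺ˡ y∈ys₁
  ... | inj₂ (here refl)   = ⊥-elim (All.lookup x∉xs y∈xs refl)
  ... | inj₂ (there y∈ys₂) = ∈-++⁺ʳ ys₁ y∈ys₂

length-cartesianProductWith : ∀ {A B C : Set} (f : A → B → C) xs ys →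
  length (cartesianProductWith f xs ys) ≡ length xs ℕ.* length ys
length-cartesianProductWith f []       ys = refl
length-cartesianProductWith f (x ∷ xs) ys = begin
  length (map (f x) ys ++ cartesianProductWith f xs ys)          ≡⟨ length-++ (map (f x) ys) ⟩
  length (map (f x) ys) ℕ.+ length (cartesianProductWith f xs ys) ≡⟨ cong₂ ℕ._+_ (length-map (f x) ys)
                                                                      (length-cartesianProductWith f xs ys) ⟩
  length ys ℕ.+ length xs ℕ.* length ys                             ∎
  where open ≡-Reasoning

sublists≤ : ∀ {A : Set} → ℕ → List A → List (List A)
sublists≤ zero    xs       = [ [] ]
sublists≤ (suc r) []       = [ [] ]
sublists≤ (suc r) (x ∷ xs) = map (x ∷_) (sublists≤ r xs) ++ sublists≤ (suc r) xs

filter-∈-sublists≤ : ∀ {A : Set} {P : A → Set} (P? : Decidable P) r xs →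
  length (filter P? xs) ℕ.≤ r → filter P? xs ∈ sublists≤ r xs
filter-∈-sublists≤ P? zero xs h with filter P? xs
... | []    = here refl
... | _ ∷ _ with () ← h
filter-∈-sublists≤ P? (suc r) [] h = here refl
filter-∈-sublists≤ P? (suc r) (x ∷ xs) h with does (P? x)
... | true  = ∈-++⁺ˡ (∈-map⁺ (x ∷_) (filter-∈-sublists≤ P? r xs (ℕₚ.≤-pred h)))
... | false = ∈-++⁺ʳ _ (filter-∈-sublists≤ P? (suc r) xs h)

infix 4 _≤*_

_≤*_ : ∀ {N} → Vec ℕ N → Vec ℕ N → Set
_≤*_ {N} = Pointwise ℕ._≤_ {N} {N}

downset : ∀ {N} → Vec ℕ N → List (Vec ℕ N)
downset []      = [ [] ]
downset (x ∷ t) = cartesianProductWith _∷_ (upTo (suc x)) (downset t)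

∈-downset⁺ : ∀ {N} {p t : Vec ℕ N} → p ≤* t → p ∈ downset t
∈-downset⁺ []          = here refl
∈-downset⁺ (x≤y ∷ p≤t) = ∈-cartesianProductWith⁺ _∷_ (∈-upTo⁺ (s≤s x≤y)) (∈-downset⁺ p≤t)

∈-downset⁻ : ∀ {N} {p : Vec ℕ N} t → p ∈ downset t → p ≤* t
∈-downset⁻ []      (here refl) = []
∈-downset⁻ (y ∷ t) p∈downset
  with _ , _ , x∈upTo , q∈downset , refl ← ∈-cartesianProductWith⁻ _∷_ (upTo (suc y)) (downset t) p∈downset
  = ℕₚ.≤-pred (∈-upTo⁻ x∈upTo) ∷ ∈-downset⁻ t q∈downset

downset-unique : ∀ {N} (t : Vec ℕ N) → Unique (downset t)
downset-unique []      = [] ∷ []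
downset-unique (x ∷ t) =
  Unique.cartesianProductWith⁺ _∷_ ∷-injective (Unique.upTo⁺ (suc x)) (downset-unique t)

length-downset-∷ : ∀ {N} x (t : Vec ℕ N) → length (downset (x ∷ t)) ≡ suc x ℕ.* length (downset t)
length-downset-∷ x t =
  trans (length-cartesianProductWith _∷_ (upTo (suc x)) (downset t))
        (cong (ℕ._* length (downset t)) (length-upTo (suc x)))

length-downset≤⇒bounded : ∀ {N} n (t : Vec ℕ N) → length (downset t) ℕ.≤ suc n → t ≤* replicate N n
length-downset≤⇒bounded n []      _ = []
length-downset≤⇒bounded n (x ∷ t) h =
  ℕₚ.≤-pred (ℕₚ.≤-trans (ℕₚ.m≤m*n (suc x) (length (downset t)) {{ℕ.>-nonZero 0<|downset|}}) h′)
  ∷ length-downset≤⇒bounded n t (ℕₚ.≤-trans (ℕₚ.m≤n*m (length (downset t)) (suc x)) h′)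
  where
  h′ : suc x ℕ.* length (downset t) ℕ.≤ suc n
  h′ = subst (ℕ._≤ suc n) (length-downset-∷ x t) h
  0<|downset| : 0 ℕ.< length (downset t)
  0<|downset| = length-mono-⊆ {xs = [ t ]} ([] ∷ [])
    λ { (here refl) → ∈-downset⁺ (Pointwise.refl ℕₚ.≤-refl) }

infix 4 _∈?_ _⊆?_

_∈?_ : ∀ {N} (t : Vec ℕ N) (D : List (Vec ℕ N)) → Dec (t ∈ D)
_∈?_ = DecMembership._∈?_ (≡-dec ℕₚ._≟_)

_⊆?_ : ∀ {N} (D E : List (Vec ℕ N)) → Dec (D ⊆ E)
_⊆?_ = DecSubset._⊆?_ (≡-dec ℕₚ._≟_)

IsIdeal : ∀ {N} → List (Vec ℕ N) → Set
IsIdeal D = All (λ s → downset s ⊆ D) D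

IsCorner : ∀ {N} → List (Vec ℕ N) → Vec ℕ N → Set
IsCorner D t = t ∉ D × downset t ⊆ t ∷ D

isIdeal? : ∀ {N} (D : List (Vec ℕ N)) → Dec (IsIdeal D)
isIdeal? D = all? (λ s → downset s ⊆? D) D

isCorner? : ∀ {N} (D : List (Vec ℕ N)) → Decidable (IsCorner D)
isCorner? D t = ¬? (t ∈? D) ×-dec (downset t ⊆? t ∷ D)

ideal-length-downset : ∀ {N} {D : List (Vec ℕ N)} {s} → IsIdeal D → s ∈ D → length (downset s) ℕ.≤ length D
ideal-length-downset {s = s} ideal s∈D = length-mono-⊆ (downset-unique s) (All.lookup ideal s∈D)

corner-length-downset : ∀ {N} {D : List (Vec ℕ N)} {t} → IsCorner D t → length (downset t) ℕ.≤ suc (length D)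
corner-length-downset {t = t} (_ , below) = length-mono-⊆ (downset-unique t) below

fewPredecessors : ∀ N → ℕ → List (Vec ℕ N)
fewPredecessors N n = filter (λ t → length (downset t) ≤? suc n) (downset (replicate N n))

fewPredecessors-unique : ∀ N n → Unique (fewPredecessors N n)
fewPredecessors-unique N n = Unique.filter⁺ _ (downset-unique (replicate N n))

∈-fewPredecessors : ∀ {N n} {t : Vec ℕ N} → length (downset t) ℕ.≤ suc n → t ∈ fewPredecessors N n
∈-fewPredecessors {n = n} {t} h = ∈-filter⁺ _ (∈-downset⁺ (length-downset≤⇒bounded n t h)) h

-- the largest number of corners of an ideal of ℕ⁴ with j ≤ 4 elements; the value for j > 4 is arbitrary
maxCorners : ℕ → ℕ
maxCorners 0 = 1
maxCorners 1 = 4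
maxCorners 2 = 4
maxCorners 3 = 5
maxCorners _ = 7

maxCorners-mono : ∀ {i j} → i ℕ.≤ j → maxCorners i ℕ.≤ maxCorners j
maxCorners-mono {j = zero}  z≤n = ℕₚ.≤-refl
maxCorners-mono {j = suc j} i≤1+j with ℕₚ.m≤n⇒m<n∨m≡n i≤1+j
... | inj₂ refl  = ℕₚ.≤-refl
... | inj₁ i<1+j = ℕₚ.≤-trans (maxCorners-mono (ℕₚ.≤-pred i<1+j)) (step j)
  where
  step : ∀ j → maxCorners j ℕ.≤ maxCorners (suc j)
  step 0 = from-yes (1 ≤? 4)
  step 1 = ℕₚ.≤-refl
  step 2 = from-yes (4 ≤? 5)
  step 3 = from-yes (5 ≤? 7)
  step (suc (suc (suc (suc _)))) = ℕₚ.≤-refl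

-- opaque: otherwise checking small-ideal-corners keeps re-evaluating this list
opaque
  smallTuples : List (Vec ℕ 4)
  smallTuples = fewPredecessors 4 4

  smallTuples-unique : Unique smallTuples
  smallTuples-unique = fewPredecessors-unique 4 4

  ∈-smallTuples : ∀ {t} → length (downset t) ℕ.≤ 5 → t ∈ smallTuples
  ∈-smallTuples = ∈-fewPredecessors

-- T is a parameter so that evaluating cornerBound? computes smallTuples only once
CornerBound : List (Vec ℕ 4) → Set
CornerBound T =
  All (λ S → IsIdeal S → length (filter (isCorner? S) T) ℕ.≤ maxCorners (length S)) (sublists≤ 4 T)

cornerBound? : (T : List (Vec ℕ 4)) → Dec (CornerBound T)
cornerBound? T =
  all? (λ S → isIdeal? S →-dec length (filter (isCorner? S) T) ≤? maxCorners (length S)) (sublists≤ 4 T)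

opaque
  unfolding smallTuples

  cornerBound : CornerBound smallTuples
  cornerBound = from-yes (cornerBound? smallTuples)

small-ideal-corners : ∀ {D M : List (Vec ℕ 4)} → IsIdeal D → length D ℕ.≤ 4 →
  Unique M → All (IsCorner D) M → length M ℕ.≤ maxCorners (length D)
small-ideal-corners {D} {M} ideal |D|≤4 M! corners = begin
  length M                                  ≤⟨ length-mono-⊆ M! M⊆corners ⟩
  length (filter (isCorner? S) smallTuples) ≤⟨ All.lookup cornerBound S∈sublists ideal-S ⟩
  maxCorners (length S)                     ≤⟨ maxCorners-mono |S|≤|D| ⟩
  maxCorners (length D)                     ∎
  where
  open ℕₚ.≤-Reasoning
  -- S has the same elements as D, and as a sublist of smallTuples it is covered by cornerBound
  S : List (Vec ℕ 4)
  S = filter (_∈? D) smallTuples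

  S⊆D : S ⊆ D
  S⊆D = proj₂ ∘ ∈-filter⁻ (_∈? D) {xs = smallTuples}

  D⊆S : D ⊆ S
  D⊆S s∈D = ∈-filter⁺ (_∈? D) (∈-smallTuples
    (ℕₚ.≤-trans (ideal-length-downset ideal s∈D) (ℕₚ.≤-trans |D|≤4 (ℕₚ.n≤1+n 4)))) s∈D

  |S|≤|D| : length S ℕ.≤ length D
  |S|≤|D| = length-mono-⊆ (Unique.filter⁺ (_∈? D) smallTuples-unique) S⊆D

  S∈sublists : S ∈ sublists≤ 4 smallTuples
  S∈sublists = filter-∈-sublists≤ (_∈? D) 4 smallTuples (ℕₚ.≤-trans |S|≤|D| |D|≤4)

  ideal-S : IsIdeal S
  ideal-S = All.tabulate λ s∈S → D⊆S ∘ All.lookup ideal (S⊆D s∈S)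

  M⊆corners : M ⊆ filter (isCorner? S) smallTuples
  M⊆corners {t} t∈M = ∈-filter⁺ (isCorner? S) t∈smallTuples (t∉D ∘ S⊆D , below-S)
    where
    corner : IsCorner D t
    corner = All.lookup corners t∈M
    t∉D : t ∉ D
    t∉D = proj₁ corner
    t∈smallTuples : t ∈ smallTuples
    t∈smallTuples = ∈-smallTuples (ℕₚ.≤-trans (corner-length-downset corner) (s≤s |D|≤4))
    below-S : downset t ⊆ t ∷ S
    below-S p∈downset with proj₂ corner p∈downset
    ... | here p≡t  = here p≡t
    ... | there p∈D = there (D⊆S p∈D)

weightedSum : ∀ {N} → Vec ℕ N → Vec ℕ N → ℕ
weightedSum []       []      = 0
weightedSum (w ∷ ws) (x ∷ t) = suc w ℕ.* x ℕ.+ weightedSum ws t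

weightedSum≤⇒bounded : ∀ {N} (ws t : Vec ℕ N) {n} → weightedSum ws t ℕ.≤ n → t ≤* replicate N n
weightedSum≤⇒bounded []       []      _ = []
weightedSum≤⇒bounded (w ∷ ws) (x ∷ t) h =
  ℕₚ.≤-trans (ℕₚ.m≤n*m x (suc w)) (ℕₚ.≤-trans (ℕₚ.m≤m+n _ _) h)
  ∷ weightedSum≤⇒bounded ws t (ℕₚ.≤-trans (ℕₚ.m≤n+m _ _) h)

levelCount : ∀ {N} {_∼_ : ℕ → ℕ → Set} → (∀ m n → Dec (m ∼ n)) → Vec ℕ N → ℕ → ℕ
levelCount _∼?_ ws n = length (filter (λ t → weightedSum ws t ∼? n) (downset (replicate _ n)))

module _ (R : RealField) where
  open RealField R
  open IsCommutativeRing isCommutativeRing using (isRing; +-comm; +-assoc; +-identityˡ; -‿inverseʳ)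
  open IsStrictTotalOrder isStrictTotalOrder using (compare; irrefl) renaming (trans to <-trans)

  ring : Ring _ _
  ring = record { isRing = isRing }

  open RingProperties ring using (-1*x≈-x; -‿involutive)

  <-irrefl : ∀ {x} → x < x → ⊥
  <-irrefl = irrefl refl

  -- if 1 < 0 then 0 < -1, hence 0 < (-1)(-1) = 1
  0<1 : 0# < 1#
  0<1 with compare 0# 1#
  ... | tri< 0<1 _ _ = 0<1
  ... | tri≈ _ 0≡1 _ = ⊥-elim (0≢1 0≡1)
  ... | tri> _ _ 1<0 = ⊥-elim (<-irrefl (<-trans 1<0 (subst (0# <_) -1*-1≡1 (*-pos 0<-1 0<-1))))
    where
    0<-1 : 0# < - 1#
    0<-1 = subst₂ _<_ (-‿inverseʳ 1#) (+-identityˡ (- 1#)) (+-mono-< (- 1#) 1<0)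
    -1*-1≡1 : - 1# * - 1# ≡ 1#
    -1*-1≡1 = trans (-1*x≈-x (- 1#)) (-‿involutive 1#)

  +-monoʳ-< : ∀ z {x y} → x < y → z + x < z + y
  +-monoʳ-< z {x} {y} x<y = subst₂ _<_ (+-comm x z) (+-comm y z) (+-mono-< z x<y)

  <-≤-trans : ∀ {x y z} → x < y → y ≤ z → x < z
  <-≤-trans x<y (inj₁ y<z) = <-trans x<y y<z
  <-≤-trans x<y (inj₂ refl) = x<y

  ≤-<-trans : ∀ {x y z} → x ≤ y → y < z → x < z
  ≤-<-trans (inj₁ x<y) y<z = <-trans x<y y<z
  ≤-<-trans (inj₂ refl) y<z = y<z

  +-monoʳ-≤ : ∀ x {z w} → z ≤ w → x + z ≤ x + w
  +-monoʳ-≤ x (inj₁ z<w)  = inj₁ (+-monoʳ-< x z<w)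
  +-monoʳ-≤ x (inj₂ refl) = inj₂ refl

  +-mono-<-≤ : ∀ {x y z w} → x < y → z ≤ w → x + z < y + w
  +-mono-<-≤ {z = z} x<y z≤w = <-≤-trans (+-mono-< z x<y) (+-monoʳ-≤ _ z≤w)

  +-mono-≤ : ∀ {x y z w} → x ≤ y → z ≤ w → x + z ≤ y + w
  +-mono-≤ (inj₁ x<y)  z≤w = inj₁ (+-mono-<-≤ x<y z≤w)
  +-mono-≤ (inj₂ refl) z≤w = +-monoʳ-≤ _ z≤w

  module _ {a : ℕ → Carrier} (increasing : ∀ i → a i < a (suc i)) where

    increasing⇒strictMono : ∀ {i j} → i ℕ.< j → a i < a j
    increasing⇒strictMono {i} {suc j} i<1+j with ℕₚ.m<1+n⇒m<n∨m≡n i<1+j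
    ... | inj₁ i<j  = <-trans (increasing⇒strictMono i<j) (increasing j)
    ... | inj₂ refl = increasing i

    increasing⇒mono : ∀ {i j} → i ℕ.≤ j → a i ≤ a j
    increasing⇒mono i≤j with ℕₚ.m≤n⇒m<n∨m≡n i≤j
    ... | inj₁ i<j  = inj₁ (increasing⇒strictMono i<j)
    ... | inj₂ refl = inj₂ refl

  specSum-mono : ∀ {N} {A : Array R N} → StrictlyIncreasing R A →
    ∀ {p t} → p ≤* t → specSum R A p ≤ specSum R A t
  specSum-mono {A = []}    _ []  = inj₂ refl
  specSum-mono {A = a ∷ A} (increasing , A↑) (x≤y ∷ p≤t) =
    +-mono-≤ (increasing⇒mono increasing x≤y) (specSum-mono A↑ p≤t)

  specSum-strictMono : ∀ {N} {A : Array R N} → StrictlyIncreasing R A →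
    ∀ {p t} → p ≤* t → p ≢ t → specSum R A p < specSum R A t
  specSum-strictMono {A = []}    _ [] p≢t = ⊥-elim (p≢t refl)
  specSum-strictMono {A = a ∷ A} (increasing , A↑) (x≤y ∷ p≤t) p≢t with ℕₚ.m≤n⇒m<n∨m≡n x≤y
  ... | inj₁ x<y  = +-mono-<-≤ (increasing⇒strictMono increasing x<y) (specSum-mono A↑ p≤t)
  ... | inj₂ refl = +-monoʳ-< _ (specSum-strictMono A↑ p≤t (p≢t ∘ cong (_ ∷_)))

  module _ {N} {A : Array R N} (A↑ : StrictlyIncreasing R A) {v : Carrier} {L : List (Vec ℕ N)}
           (L⇔ : ∀ t → t ∈ L ⇔ specSum R A t < v) where
    open Equivalence

    sublevel-ideal : IsIdeal L
    sublevel-ideal = All.tabulate λ {s} s∈L p∈downset →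
      from (L⇔ _) (≤-<-trans (specSum-mono A↑ (∈-downset⁻ s p∈downset)) (to (L⇔ s) s∈L))

    level-corner : ∀ {t} → specSum R A t ≡ v → IsCorner L t
    level-corner {t} St≡v = t∉L , below
      where
      t∉L : t ∉ L
      t∉L t∈L = <-irrefl (subst (_< v) St≡v (to (L⇔ t) t∈L))
      below : downset t ⊆ t ∷ L
      below {p} p∈downset with ≡-dec ℕₚ._≟_ p t
      ... | yes p≡t = here p≡t
      ... | no  p≢t = there (from (L⇔ p)
        (subst (specSum R A p <_) St≡v (specSum-strictMono A↑ (∈-downset⁻ t p∈downset) p≢t)))

  multiplicity-bound : ∀ {A : Array R 4} {k m} → StrictlyIncreasing R A → k ℕ.≤ 4 →
    MultOfKth R A (suc k) m → m ℕ.≤ maxCorners k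
  multiplicity-bound {k = k} A↑ k≤4 (_ , ((_ , (L , refl , _ , L⇔) , |L|<1+k) , _) , (M , refl , M! , M⇔)) =
    ℕₚ.≤-trans (small-ideal-corners (sublevel-ideal A↑ L⇔) (ℕₚ.≤-trans |L|≤k k≤4) M! corners)
               (maxCorners-mono |L|≤k)
    where
    |L|≤k : length L ℕ.≤ k
    |L|≤k = ℕₚ.≤-pred |L|<1+k
    corners : All (IsCorner L) M
    corners = All.tabulate λ {t} t∈M → level-corner A↑ L⇔ (Equivalence.to (M⇔ t) t∈M)

  fromℕ : ℕ → Carrier
  fromℕ zero    = 0#
  fromℕ (suc n) = 1# + fromℕ n

  fromℕ-+ : ∀ m n → fromℕ (m ℕ.+ n) ≡ fromℕ m + fromℕ n
  fromℕ-+ zero    n = sym (+-identityˡ (fromℕ n))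
  fromℕ-+ (suc m) n = trans (cong (1# +_) (fromℕ-+ m n)) (sym (+-assoc 1# (fromℕ m) (fromℕ n)))

  fromℕ-increasing : ∀ n → fromℕ n < fromℕ (suc n)
  fromℕ-increasing n = subst (_< fromℕ (suc n)) (+-identityˡ (fromℕ n)) (+-mono-< (fromℕ n) 0<1)

  fromℕ-strictMono : ∀ {m n} → m ℕ.< n → fromℕ m < fromℕ n
  fromℕ-strictMono = increasing⇒strictMono fromℕ-increasing

  fromℕ-<-⇔ : ∀ {m n} → m ℕ.< n ⇔ fromℕ m < fromℕ n
  fromℕ-<-⇔ {m} {n} = mk⇔ fromℕ-strictMono cancel
    where
    cancel : fromℕ m < fromℕ n → m ℕ.< n
    cancel fm<fn with ℕₚ.<-cmp m n
    ... | tri< m<n _ _  = m<n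
    ... | tri≈ _ refl _ = ⊥-elim (<-irrefl fm<fn)
    ... | tri> _ _ n<m  = ⊥-elim (<-irrefl (<-trans fm<fn (fromℕ-strictMono n<m)))

  fromℕ-≡-⇔ : ∀ {m n} → m ≡ n ⇔ fromℕ m ≡ fromℕ n
  fromℕ-≡-⇔ {m} {n} = mk⇔ (cong fromℕ) cancel
    where
    cancel : fromℕ m ≡ fromℕ n → m ≡ n
    cancel fm≡fn with ℕₚ.<-cmp m n
    ... | tri< m<n _ _ = ⊥-elim (<-irrefl (subst (_< fromℕ n) fm≡fn (fromℕ-strictMono m<n)))
    ... | tri≈ _ m≡n _ = m≡n
    ... | tri> _ _ n<m = ⊥-elim (<-irrefl (subst (fromℕ n <_) fm≡fn (fromℕ-strictMono n<m)))

  weightedArray : ∀ {N} → Vec ℕ N → Array R N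
  weightedArray []       = []
  weightedArray (w ∷ ws) = (λ j → fromℕ (suc w ℕ.* j)) ∷ weightedArray ws

  weightedArray-increasing : ∀ {N} (ws : Vec ℕ N) → StrictlyIncreasing R (weightedArray ws)
  weightedArray-increasing []       = _
  weightedArray-increasing (w ∷ ws) =
    (λ j → fromℕ-strictMono (ℕₚ.*-monoʳ-< (suc w) (ℕₚ.n<1+n j))) , weightedArray-increasing ws

  specSum-weightedArray : ∀ {N} (ws t : Vec ℕ N) → specSum R (weightedArray ws) t ≡ fromℕ (weightedSum ws t)
  specSum-weightedArray []       []      = refl
  specSum-weightedArray (w ∷ ws) (x ∷ t) =
    trans (cong (fromℕ (suc w ℕ.* x) +_) (specSum-weightedArray ws t))
          (sym (fromℕ-+ (suc w ℕ.* x) (weightedSum ws t)))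

  countIs-filter : ∀ {N} {P Q : Vec ℕ N → Set} (Q? : Decidable Q) {xs} → Unique xs →
    (∀ {t} → Q t → t ∈ xs) → (∀ {t} → Q t ⇔ P t) → CountIs R P (length (filter Q? xs))
  countIs-filter Q? {xs} xs! Q⊆xs Q⇔P =
    filter Q? xs , refl , Unique.filter⁺ Q? xs! ,
    λ t → mk⇔ (to Q⇔P ∘ proj₂ ∘ ∈-filter⁻ Q? {xs = xs})
              (λ Pt → ∈-filter⁺ Q? (Q⊆xs (from Q⇔P Pt)) (from Q⇔P Pt))
    where open Equivalence

  atLeast-filter : ∀ {N} {P Q : Vec ℕ N → Set} (Q? : Decidable Q) {xs} k → Unique xs →
    k ℕ.≤ length (filter Q? xs) → (∀ {t} → Q t → P t) → AtLeast R P k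
  atLeast-filter Q? {xs} k xs! k≤|filter| Q⇒P =
    take k (filter Q? xs) , trans (length-take k _) (ℕₚ.m≤n⇒m⊓n≡m k≤|filter|) ,
    Unique.take⁺ k (Unique.filter⁺ Q? xs!) , AllP.take⁺ k (All.map Q⇒P (AllP.all-filter Q? xs))

  weightedArray-multOfKth : ∀ {N} (ws : Vec ℕ N) n k →
    levelCount _<?_ ws n ℕ.< k → k ℕ.≤ levelCount _≤?_ ws n →
    MultOfKth R (weightedArray ws) k (levelCount ℕ._≟_ ws n)
  weightedArray-multOfKth ws n k below<k k≤atMost =
    fromℕ n ,
    ( (_ , countIs-filter _ cube! (∈-cube ∘ ℕₚ.<⇒≤) sum<n⇔ , below<k)
    , atLeast-filter _ k cube! k≤atMost sum≤n⇒ ) ,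
    countIs-filter _ cube! (∈-cube ∘ ℕₚ.≤-reflexive) sum≡n⇔
    where
    S : Vec ℕ _ → Carrier
    S = specSum R (weightedArray ws)
    cube! : Unique (downset (replicate _ n))
    cube! = downset-unique (replicate _ n)
    ∈-cube : ∀ {t} → weightedSum ws t ℕ.≤ n → t ∈ downset (replicate _ n)
    ∈-cube {t} = ∈-downset⁺ ∘ weightedSum≤⇒bounded ws t
    sum<n⇔ : ∀ {t} → weightedSum ws t ℕ.< n ⇔ S t < fromℕ n
    sum<n⇔ {t} rewrite specSum-weightedArray ws t = fromℕ-<-⇔
    sum≡n⇔ : ∀ {t} → weightedSum ws t ≡ n ⇔ S t ≡ fromℕ n
    sum≡n⇔ {t} rewrite specSum-weightedArray ws t = fromℕ-≡-⇔
    sum≤n⇒ : ∀ {t} → weightedSum ws t ℕ.≤ n → S t ≤ fromℕ n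
    sum≤n⇒ {t} rewrite specSum-weightedArray ws t = increasing⇒mono fromℕ-increasing

  supMultIs-weighted : ∀ {k} (ws : Vec ℕ 4) n → True (k ≤? 4) →
    True (levelCount _<?_ ws n ≤? k) → True (suc k ≤? levelCount _≤?_ ws n) →
    levelCount ℕ._≟_ ws n ≡ maxCorners k → SupMultIs R 4 (suc k) (maxCorners k)
  supMultIs-weighted {k} ws n k≤4 below≤k 1+k≤atMost count≡ =
    (λ _ A↑ _ → multiplicity-bound A↑ (toWitness k≤4)) ,
    weightedArray ws , weightedArray-increasing ws ,
    subst (MultOfKth R (weightedArray ws) (suc k)) count≡
      (weightedArray-multOfKth ws n (suc k) (s≤s (toWitness below≤k)) (toWitness 1+k≤atMost))

mainTheorem8 : (R : RealField) →
    SupMultIs R 4 1 1 × SupMultIs R 4 2 4 × SupMultIs R 4 3 4 ×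
    SupMultIs R 4 4 5 × SupMultIs R 4 5 7
mainTheorem8 R =
  supMultIs-weighted R (0 ∷ 0 ∷ 0 ∷ 0 ∷ []) 0 _ _ _ refl ,
  supMultIs-weighted R (0 ∷ 0 ∷ 0 ∷ 0 ∷ []) 1 _ _ _ refl ,
  supMultIs-weighted R (0 ∷ 0 ∷ 0 ∷ 0 ∷ []) 1 _ _ _ refl ,
  supMultIs-weighted R (0 ∷ 0 ∷ 1 ∷ 1 ∷ []) 2 _ _ _ refl ,
  supMultIs-weighted R (0 ∷ 0 ∷ 0 ∷ 1 ∷ []) 2 _ _ _ refl
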